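{- Let $d\ge1$, fix a total ordering $\epsilon_1<\dots<\epsilon_{2d}$ of $E_d$, and consider the rotor-router growth model on $\mathbb{Z}^d$ described in the context. For $m\ge1$ let $H_m(x)$ be the total number of times the site $x\in\mathbb{Z}^d$ is visited by the first $m$ deposited particles. Then for every $x\ne\mathbf 0$ and every $m$, $$-d+\frac32-\frac1{2d}\le \Delta H_m(x)\le d+\frac12.$$
   Context: $E_d=\{\pm e_1,\dots,\pm e_d\}$ with $e_i$ the standard basis of $\mathbb{Z}^d$. The discrete Laplacian of $F:\mathbb{Z}^d\to\mathbb{R}$ is $\Delta F(x)=\frac1{2d}\sum_{\epsilon\in E_d}F(x+\epsilon)-F(x)$. Growth process: initially no site is occupied; each particle is placed at the origin; while it is at an occupied site $x$ it moves to $x+(\text{rotor direction at }x)$ and the rotor at $x$ is advanced to the next direction in the cyclic order $\epsilon_1\to\epsilon_2\to\dots\to\epsilon_{2d}\to\epsilon_1$; when it reaches an unoccupied site it stops there and that site becomes occupied with rotor $\epsilon_1$. A visit to $x$ is any time a particle is located at $x$ (including its placement at the origin and the arrival at its final site). -}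

module Defs where

open import Data.Nat as ℕ using (ℕ; zero; suc; NonZero)
open import Data.Nat.Properties using (m*n≢0)
open import Data.Nat.DivMod using (_%_; m%n<n)
open import Data.Integer as ℤ using (ℤ; +_)
open import Data.Rational as ℚ using (ℚ)
open import Data.Fin using (Fin; fromℕ<)
open import Data.List using (List; map; foldr; allFin)
open import Function.Definitions using (Bijective)
open import Data.Vec using (Vec; updateAt; replicate)
open import Data.Vec.Properties using (≡-dec)
open import Data.Bool using (Bool; true; false)
open import Data.Product using (_×_; _,_)
open import Relation.Nullary using (yes; no)
open import Relation.Binary.PropositionalEquality using (_≡_)

Site : ℕ → Set
Site d = Vec ℤ d

origin : (d : ℕ) → Site d
origin d = replicate d (+ 0)

-- E_d : the 2d unit vectors ±e_i, encoded as (i , sign), true = +e_i, false = -e_i.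
Dir : ℕ → Set
Dir d = Fin d × Bool

_⊕_ : ∀ {d} → Site d → Dir d → Site d
x ⊕ (i , true)  = updateAt x i (λ a → a ℤ.+ + 1)
x ⊕ (i , false) = updateAt x i (λ a → a ℤ.- + 1)

sumE : ∀ {d} → (Site d → ℤ) → Site d → ℤ
sumE {d} F x = foldr ℤ._+_ (+ 0) (map (λ i → F (x ⊕ (i , true)) ℤ.+ F (x ⊕ (i , false))) (allFin d))

nonZero2d : ∀ d → .{{NonZero d}} → NonZero (2 ℕ.* d)
nonZero2d d = m*n≢0 2 d

Δ : ∀ {d} → .{{NonZero d}} → (Site d → ℤ) → Site d → ℚ
Δ {d} F x = (sumE F x ℚ./ (2 ℕ.* d)) ℚ.- (F x ℚ./ 1)
  where instance _ = nonZero2d d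

upd : ∀ {d} {A : Set} → (Site d → A) → Site d → A → Site d → A
upd f x a y with ≡-dec ℤ._≟_ y x
... | yes _ = a
... | no  _ = f y

-- Global state of the growth process:
--   occ x : is x occupied;
--   rot x : number of times the rotor at x has been advanced
--           (the rotor at x currently points to ε_{(rot x mod 2d) + 1});
--   H x   : number of visits to x so far.
record State (d : ℕ) : Set where
  constructor st
  field
    occ : Site d → Bool
    rot : Site d → ℕ
    H   : Site d → ℕ
open State public

initState : ∀ d → State d
initState d = st (λ _ → false) (λ _ → 0) (λ _ → 0)

-- Model parameters: d ≥ 1 and a total ordering ε₁ < … < ε_{2d} of E_d,
-- given as a bijection ord : Fin (2d) → E_d (ord k = ε_{k+1}).
module Rotor (d : ℕ) .{{_ : NonZero d}} (ord : Fin (2 ℕ.* d) → Dir d) where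

  rotorDir : State d → Site d → Dir d
  rotorDir s x = ord (fromℕ< (m%n<n (rot s x) (2 ℕ.* d)))
    where instance _ = nonZero2d d

  visit : State d → Site d → State d
  visit s y = st (occ s) (rot s) (upd (H s) y (suc (H s y)))

  -- Walk s x s' : a particle sitting at x in state s (its visit to x already
  -- counted) finishes its walk, leaving the process in state s'.
  data Walk : State d → Site d → State d → Set where
    stop : ∀ {s x} → occ s x ≡ false →
           Walk s x (st (upd (occ s) x true) (upd (rot s) x 0) (H s))
    step : ∀ {s x s'} → occ s x ≡ true →
           Walk (visit (st (occ s) (upd (rot s) x (suc (rot s x))) (H s))
                       (x ⊕ rotorDir s x))
                (x ⊕ rotorDir s x) s' →
           Walk s x s'

  -- Run m s : s is the state after the first m particles have been deposited
  -- (each placed at the origin, counted as a visit there, then walking).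
  data Run : ℕ → State d → Set where
    run0 : Run 0 (initState d)
    runS : ∀ {m s s'} → Run m s → Walk (visit s (origin d)) (origin d) s' →
           Run (suc m) s'

  Hℤ : State d → Site d → ℤ
  Hℤ s x = + (H s x)

lowerBound : (d : ℕ) → .{{NonZero d}} → ℚ
lowerBound d = (ℤ.- (+ d)) ℚ./ 1 ℚ.+ (+ 3) ℚ./ 2 ℚ.- (+ 1) ℚ./ (2 ℕ.* d)
  where instance _ = nonZero2d d

upperBound : (d : ℕ) → ℚ
upperBound d = (+ d) ℚ./ 1 ℚ.+ (+ 1) ℚ./ 2

{-# OPTIONS --safe #-}
-- A visit to a site x ≠ 0 is always the arrival of a particle sent by the rotor of a neighbour
-- y = x − ε while that rotor pointed in direction ε.  After D advances a rotor has pointed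
-- ⌊D/2d⌋ + 1 times in each of its first D mod 2d directions and ⌊D/2d⌋ times in the others,
-- and an occupied site has been visited once more than its rotor has advanced (a vacant one
-- never).  Hence each neighbour y, reached through direction ε_{k+1} of the ordering, satisfies
-- −(2d − 2 − k)⁺ ≤ H(y) − 2d·(number of particles y sent to x) ≤ k + 1, and summing over k gives
-- −(2d − 1)(2d − 2)/2 ≤ Σ_y H(y) − 2d·H(x) ≤ 2d(2d + 1)/2; divide by 2d.
module Submission where

open import Defs
open import Data.Nat as ℕ using (ℕ; zero; suc; _+_; _*_; _∸_; _≤_; _<_; NonZero; z≤n; s≤s; _<?_; _≥_)
open import Data.Nat.Properties as ℕP
open import Data.Nat.DivMod using (_%_; _/_; m%n<n; m≡m%n+[m/n]*n; [m+kn]%n≡m%n; m<n⇒m%n≡m)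
open import Data.Nat.Tactic.RingSolver using (solve-∀)
open import Data.Integer as ℤ using (ℤ)
import Data.Integer.Properties as ℤP
open import Data.Rational as ℚ using (ℚ; toℚᵘ)
open import Data.Fin as F using (Fin; toℕ; fromℕ<; _↑ˡ_; _↑ʳ_; combine)
open import Data.Fin.Properties using (toℕ-inject₁; toℕ-fromℕ; toℕ-fromℕ<; toℕ-injective; toℕ<n; *↔×; 2↔Bool; remQuot-combine)
open import Data.Fin.Patterns using (0F; 1F)
open import Data.Fin.Permutation using (Permutation; _⟨$⟩ʳ_)
open import Data.Vec using (Vec; updateAt; lookup)
open import Data.Vec.Properties using (≡-dec; updateAt-updateAt-local; updateAt-id)
open import Data.List as List using (tabulate)
import Data.List.Properties as List
open import Data.Bool using (Bool; true; false; not)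
open import Data.Product using (_×_; _,_; proj₁; proj₂)
open import Data.Product.Algebra using (×-comm)
open import Data.Product.Function.NonDependent.Propositional using (_×-↔_)
open import Function using (_∘_; id; _↔_; Inverse; _⇔_; Equivalence)
open import Function.Bundles using (mk⤖; mk⇔)
open import Function.Construct.Composition using (_↔-∘_)
open import Function.Construct.Symmetry using (↔-sym)
open import Function.Construct.Identity using (↔-id)
open import Function.Definitions using (Bijective)
open import Function.Properties.Bijection using (⤖⇒↔)
open import Relation.Nullary using (Dec; yes; no; does; ¬_; contradiction)
open import Relation.Nullary.Decidable using (dec-true; dec-false)
open import Relation.Binary.PropositionalEquality
open import Relation.Binary.Definitions using (DecidableEquality)
open import Algebra.Properties.Semiring.Sum ℕP.+-*-semiring
  using (sum; sum-syntax; sum-cong-≗; ∑-distrib-+; *-distribˡ-sum; sum-permute; sum-replicate-zero; sum-init-last)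

bit : Bool → ℕ
bit false = 0
bit true  = 1

𝟙 : {A : Set} → Dec A → ℕ
𝟙 a? = bit (does a?)

module _ {A : Set} (a? : Dec A) where

  𝟙-yes : A → 𝟙 a? ≡ 1
  𝟙-yes a = cong bit (dec-true a? a)

  𝟙-no : ¬ A → 𝟙 a? ≡ 0
  𝟙-no ¬a = cong bit (dec-false a? ¬a)

𝟙-cong-⇔ : {A B : Set} (a? : Dec A) (b? : Dec B) → A ⇔ B → 𝟙 a? ≡ 𝟙 b?
𝟙-cong-⇔ a? b? A⇔B with a? | b?
... | yes _ | yes _ = refl
... | no  _ | no  _ = refl
... | yes a | no ¬b = contradiction (Equivalence.to A⇔B a) ¬b
... | no ¬a | yes b = contradiction (Equivalence.from A⇔B b) ¬a

sum-mono-≤ : ∀ {n} {f g : Fin n → ℕ} → (∀ k → f k ≤ g k) → sum f ≤ sum g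
sum-mono-≤ {zero}  f≤g = z≤n
sum-mono-≤ {suc n} f≤g = +-mono-≤ (f≤g 0F) (sum-mono-≤ (f≤g ∘ F.suc))

sum-pick : ∀ {n} (f : Fin n → ℕ) (i : Fin n) → ∑[ k < n ] (f k * 𝟙 (i F.≟ k)) ≡ f i
sum-pick {suc n} f 0F = begin
  f 0F * 1 + ∑[ k < n ] (f (F.suc k) * 0) ≡⟨ cong₂ _+_ (*-identityʳ _) (sum-cong-≗ (*-zeroʳ ∘ f ∘ F.suc)) ⟩
  f 0F + ∑[ k < n ] 0                     ≡⟨ cong (_+_ (f 0F)) (sum-replicate-zero n) ⟩
  f 0F + 0                                ≡⟨ +-identityʳ _ ⟩
  f 0F                                    ∎
  where open ≡-Reasoning
sum-pick {suc n} f (F.suc i) =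
  trans (cong (_+ ∑[ k < n ] (f (F.suc k) * 𝟙 (i F.≟ k))) (*-zeroʳ (f 0F))) (sum-pick (f ∘ F.suc) i)

sum-↑ : ∀ m {n} (f : Fin (m + n) → ℕ) → sum f ≡ ∑[ i < m ] f (i ↑ˡ n) + ∑[ j < n ] f (m ↑ʳ j)
sum-↑ zero    f = refl
sum-↑ (suc m) {n} f = trans (cong (_+_ (f 0F)) (sum-↑ m (f ∘ F.suc)))
  (sym (+-assoc (f 0F) (∑[ i < m ] f (F.suc (i ↑ˡ n))) (∑[ j < n ] f (F.suc (m ↑ʳ j)))))

2*∑suc≡ : ∀ n → 2 * ∑[ k < n ] suc (toℕ k) ≡ n * suc n
2*∑suc≡ zero    = refl
2*∑suc≡ (suc n) = begin
  2 * ∑[ k < suc n ] suc (toℕ k)                             ≡⟨ cong (2 *_) (sum-init-last {n} (λ k → suc (toℕ k))) ⟩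
  2 * (∑[ k < n ] suc (toℕ (F.inject₁ k)) + suc (toℕ (F.fromℕ n)))
    ≡⟨ cong₂ (λ a b → 2 * (a + suc b)) (sum-cong-≗ {n} (cong suc ∘ toℕ-inject₁)) (toℕ-fromℕ n) ⟩
  2 * (∑[ k < n ] suc (toℕ k) + suc n)                       ≡⟨ *-distribˡ-+ 2 (∑[ k < n ] suc (toℕ k)) (suc n) ⟩
  2 * ∑[ k < n ] suc (toℕ k) + 2 * suc n                     ≡⟨ cong (_+ 2 * suc n) (2*∑suc≡ n) ⟩
  n * suc n + 2 * suc n                                      ≡⟨ expand n ⟩
  suc n * suc (suc n)                                        ∎
  where
  open ≡-Reasoning
  expand : ∀ n → n * suc n + 2 * suc n ≡ suc n * suc (suc n)
  expand = solve-∀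

2*∑∸≤ : ∀ n m → 2 * ∑[ k < n ] (m ∸ toℕ k) ≤ m * suc m
2*∑∸≤ zero    m       = z≤n
2*∑∸≤ (suc n) zero    = ≤-reflexive (cong (2 *_) (sum-replicate-zero n))
2*∑∸≤ (suc n) (suc m) = begin
  2 * (suc m + ∑[ k < n ] (m ∸ toℕ k))     ≡⟨ *-distribˡ-+ 2 (suc m) _ ⟩
  2 * suc m + 2 * ∑[ k < n ] (m ∸ toℕ k)   ≤⟨ +-monoʳ-≤ (2 * suc m) (2*∑∸≤ n m) ⟩
  2 * suc m + m * suc m                    ≡⟨ *-distribʳ-+ (suc m) 2 m ⟨
  (2 + m) * suc m                          ≡⟨ *-comm (2 + m) (suc m) ⟩
  suc m * suc (suc m)                      ∎
  where open ≤-Reasoning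

opposite : ∀ {d} → Dir d → Dir d
opposite (i , b) = (i , not b)

updateAt-cancel : ∀ {n} {A : Set} (xs : Vec A n) i {f g : A → A} →
                  (∀ a → g (f a) ≡ a) → updateAt (updateAt xs i f) i g ≡ xs
updateAt-cancel xs i g∘f≗id = trans (updateAt-updateAt-local i {h = id} xs (g∘f≗id (lookup xs i))) (updateAt-id i xs)

⊕-opposite : ∀ {d} (x : Site d) (ε : Dir d) → (x ⊕ ε) ⊕ opposite ε ≡ x
⊕-opposite x (i , true)  = updateAt-cancel x i (λ a → trans (ℤP.+-assoc a (ℤ.+ 1) (ℤ.- ℤ.+ 1)) (ℤP.+-identityʳ a))
⊕-opposite x (i , false) = updateAt-cancel x i (λ a → trans (ℤP.+-assoc a (ℤ.- ℤ.+ 1) (ℤ.+ 1)) (ℤP.+-identityʳ a))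

⊕-opposite⁻¹ : ∀ {d} (x : Site d) (ε : Dir d) → (x ⊕ opposite ε) ⊕ ε ≡ x
⊕-opposite⁻¹ x (i , true)  = ⊕-opposite x (i , false)
⊕-opposite⁻¹ x (i , false) = ⊕-opposite x (i , true)

⊕-opposite-≡⇔ : ∀ {d} (x y : Site d) (ε : Dir d) → (x ⊕ opposite ε ≡ y) ⇔ (x ≡ y ⊕ ε)
⊕-opposite-≡⇔ x y ε = mk⇔ (λ eq → trans (sym (⊕-opposite⁻¹ x ε)) (cong (_⊕ ε) eq))
                          (λ eq → trans (cong (_⊕ opposite ε) eq) (⊕-opposite y ε))

enumerate : ∀ {d} → Fin (2 * d) ↔ Dir d
enumerate {d} = (↔-id (Fin d) ×-↔ 2↔Bool) ↔-∘ (×-comm (Fin 2) (Fin d) ↔-∘ *↔× {2} {d})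

sum-enumerate : ∀ {d} (G : Dir d → ℕ) →
                ∑[ k < 2 * d ] G (Inverse.to enumerate k) ≡ ∑[ i < d ] (G (i , false) + G (i , true))
sum-enumerate {d} G = begin
  ∑[ k < 2 * d ] G (to k)
    ≡⟨ sum-↑ d (G ∘ to) ⟩
  ∑[ i < d ] G (to (i ↑ˡ (d + 0))) + ∑[ j < d + 0 ] G (to (d ↑ʳ j))
    ≡⟨ cong (_+_ (∑[ i < d ] G (to (i ↑ˡ (d + 0))))) (sum-↑ d {0} (λ j → G (to (d ↑ʳ j)))) ⟩
  ∑[ i < d ] G (to (combine {2} 0F i)) + (∑[ i < d ] G (to (combine {2} 1F i)) + 0)
    ≡⟨ cong₂ (λ a b → a + (b + 0)) (sum-cong-≗ {d} (at 0F)) (sum-cong-≗ {d} (at 1F)) ⟩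
  ∑[ i < d ] G (i , false) + (∑[ i < d ] G (i , true) + 0)
    ≡⟨ cong (_+_ (∑[ i < d ] G (i , false))) (+-identityʳ _) ⟩
  ∑[ i < d ] G (i , false) + ∑[ i < d ] G (i , true)
    ≡⟨ ∑-distrib-+ (λ i → G (i , false)) (λ i → G (i , true)) ⟨
  ∑[ i < d ] (G (i , false) + G (i , true)) ∎
  where
  open ≡-Reasoning
  to = Inverse.to (enumerate {d})
  at : ∀ b i → G (to (combine {2} b i)) ≡ G (i , Inverse.to 2↔Bool b)
  at b i = cong (λ p → G (proj₂ p , Inverse.to 2↔Bool (proj₁ p))) (remQuot-combine b i)

sum-∘-bijection : ∀ {d} (σ : Fin (2 * d) → Dir d) → Bijective _≡_ _≡_ σ → (G : Dir d → ℕ) →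
                  ∑[ k < 2 * d ] G (σ k) ≡ ∑[ i < d ] (G (i , false) + G (i , true))
sum-∘-bijection {d} σ σ-bij G = begin
  ∑[ k < 2 * d ] G (σ k)
    ≡⟨ sum-cong-≗ {2 * d} (λ k → cong G (Inverse.strictlyInverseˡ enumerate (σ k))) ⟨
  ∑[ k < 2 * d ] G (Inverse.to enumerate (π ⟨$⟩ʳ k))
    ≡⟨ sum-permute (G ∘ Inverse.to enumerate) π ⟨
  ∑[ k < 2 * d ] G (Inverse.to enumerate k)
    ≡⟨ sum-enumerate G ⟩
  ∑[ i < d ] (G (i , false) + G (i , true)) ∎
  where
  open ≡-Reasoning
  π : Permutation (2 * d) (2 * d)
  π = ↔-sym enumerate ↔-∘ ⤖⇒↔ (mk⤖ σ-bij)

foldr-+-tabulate : ∀ n (f : Fin n → ℕ) → List.foldr ℤ._+_ (ℤ.+ 0) (tabulate (λ i → ℤ.+ f i)) ≡ ℤ.+ sum f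
foldr-+-tabulate zero    f = refl
foldr-+-tabulate (suc n) f = cong (ℤ._+_ (ℤ.+ f 0F)) (foldr-+-tabulate n (f ∘ F.suc))

sumE-+ : ∀ {d} (h : Site d → ℕ) (x : Site d) →
         sumE (λ y → ℤ.+ h y) x ≡ ℤ.+ ∑[ i < d ] (h (x ⊕ (i , true)) + h (x ⊕ (i , false)))
sumE-+ {d} h x =
  trans (cong (List.foldr ℤ._+_ (ℤ.+ 0)) (List.map-tabulate {n = d} id (λ i → ℤ.+ (h (x ⊕ (i , true)) + h (x ⊕ (i , false))))))
        (foldr-+-tabulate d _)

infix 4 _≟ˢ_
_≟ˢ_ : ∀ {d} → DecidableEquality (Site d)
_≟ˢ_ = ≡-dec ℤ._≟_

module _ {d : ℕ} {A : Set} (f : Site d → A) (x : Site d) where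

  upd-≢ : ∀ a {y} → y ≢ x → upd f x a y ≡ f y
  upd-≢ a {y} y≢x with y ≟ˢ x
  ... | yes y≡x = contradiction y≡x y≢x
  ... | no  _   = refl

  upd-self : ∀ {a} → f x ≡ a → ∀ y → upd f x a y ≡ f y
  upd-self fx≡a y with y ≟ˢ x
  ... | yes refl = sym fx≡a
  ... | no  _    = refl

upd-suc : ∀ {d} (f : Site d → ℕ) (x y : Site d) → upd f x (suc (f x)) y ≡ f y + 𝟙 (y ≟ˢ x)
upd-suc f x y with y ≟ˢ x
... | yes refl = +-comm 1 (f y)
... | no  _    = sym (+-identityʳ (f y))

𝟙<+𝟙≡ : ∀ a r → 𝟙 (a <? r) + 𝟙 (r ≟ a) ≡ 𝟙 (a <? suc r)
𝟙<+𝟙≡ zero    zero    = refl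
𝟙<+𝟙≡ zero    (suc r) = refl
𝟙<+𝟙≡ (suc a) zero    = refl
𝟙<+𝟙≡ (suc a) (suc r) = 𝟙<+𝟙≡ a r

module RotorCount (n : ℕ) .{{_ : NonZero n}} where

  slot : ℕ → Fin n
  slot D = fromℕ< (m%n<n D n)

  emitted : ℕ → Fin n → ℕ
  emitted zero    k = 0
  emitted (suc D) k = emitted D k + 𝟙 (slot D F.≟ k)

  toℕ-slot : ∀ q r → r < n → toℕ (slot (r + q * n)) ≡ r
  toℕ-slot q r r<n = trans (toℕ-fromℕ< _) (trans ([m+kn]%n≡m%n r q n) (m<n⇒m%n≡m r<n))

  emitted-quotRem : ∀ q r k → r ≤ n → emitted (r + q * n) k ≡ q + 𝟙 (toℕ k <? r)
  emitted-quotRem zero    zero    k _   = refl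
  emitted-quotRem (suc q) zero    k _   = begin
    emitted (n + q * n) k  ≡⟨ emitted-quotRem q n k ≤-refl ⟩
    q + 𝟙 (toℕ k <? n)     ≡⟨ cong (q +_) (𝟙-yes (toℕ k <? n) (toℕ<n k)) ⟩
    q + 1                  ≡⟨ +-comm q 1 ⟩
    suc q                  ≡⟨ +-identityʳ (suc q) ⟨
    suc q + 0              ∎
    where open ≡-Reasoning
  emitted-quotRem q       (suc r) k r<n = begin
    emitted (r + q * n) k + 𝟙 (slot (r + q * n) F.≟ k)
      ≡⟨ cong₂ _+_ (emitted-quotRem q r k (<⇒≤ r<n)) (𝟙-cong-⇔ (slot (r + q * n) F.≟ k) (r ≟ toℕ k) slot≡k⇔) ⟩
    q + 𝟙 (toℕ k <? r) + 𝟙 (r ≟ toℕ k)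
      ≡⟨ +-assoc q _ _ ⟩
    q + (𝟙 (toℕ k <? r) + 𝟙 (r ≟ toℕ k))
      ≡⟨ cong (q +_) (𝟙<+𝟙≡ (toℕ k) r) ⟩
    q + 𝟙 (toℕ k <? suc r) ∎
    where
    open ≡-Reasoning
    slot≡k⇔ : (slot (r + q * n) ≡ k) ⇔ (r ≡ toℕ k)
    slot≡k⇔ = mk⇔ (λ eq → trans (sym (toℕ-slot q r r<n)) (cong toℕ eq))
                  (λ eq → toℕ-injective (trans (toℕ-slot q r r<n) eq))

  private
    n*[q+b]≡ : ∀ q b → n * (q + b) ≡ n * b + q * n
    n*[q+b]≡ q b = trans (*-distribˡ-+ n q b) (trans (+-comm (n * q) (n * b)) (cong (n * b +_) (*-comm n q)))

  quotRem-lower : ∀ q r (k : Fin n) → r < n → r + q * n ≤ n * (q + 𝟙 (toℕ k <? r)) + toℕ k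
  quotRem-lower q r k r<n = by-cases (toℕ k <? r)
    where
    open ≤-Reasoning
    by-cases : (k<r? : Dec (toℕ k < r)) → r + q * n ≤ n * (q + 𝟙 k<r?) + toℕ k
    by-cases (yes _)   = begin
      r + q * n           ≤⟨ +-monoˡ-≤ (q * n) (<⇒≤ r<n) ⟩
      n + q * n           ≡⟨ cong (_+ q * n) (*-identityʳ n) ⟨
      n * 1 + q * n       ≡⟨ n*[q+b]≡ q 1 ⟨
      n * (q + 1)         ≤⟨ m≤m+n _ (toℕ k) ⟩
      n * (q + 1) + toℕ k ∎
    by-cases (no  k≮r) = begin
      r + q * n           ≤⟨ +-monoˡ-≤ (q * n) (≮⇒≥ k≮r) ⟩
      toℕ k + q * n       ≡⟨ +-comm (toℕ k) (q * n) ⟩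
      q * n + toℕ k       ≡⟨ cong (_+ toℕ k) (trans (n*[q+b]≡ q 0) (cong (_+ q * n) (*-zeroʳ n))) ⟨
      n * (q + 0) + toℕ k ∎

  quotRem-upper : ∀ q r (k : Fin n) → r < n → n * (q + 𝟙 (toℕ k <? r)) ≤ suc (r + q * n) + (n ∸ 2 ∸ toℕ k)
  quotRem-upper q r k r<n = by-cases (toℕ k <? r)
    where
    open ≤-Reasoning
    by-cases : (k<r? : Dec (toℕ k < r)) → n * (q + 𝟙 k<r?) ≤ suc (r + q * n) + (n ∸ 2 ∸ toℕ k)
    by-cases (yes k<r) = begin
      n * (q + 1)                               ≡⟨ n*[q+b]≡ q 1 ⟩
      n * 1 + q * n                             ≡⟨ cong (_+ q * n) (*-identityʳ n) ⟩
      n + q * n                                 ≡⟨ cong (_+ q * n) (m+[n∸m]≡n 2+k≤n) ⟨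
      2 + toℕ k + (n ∸ (2 + toℕ k)) + q * n     ≤⟨ +-monoˡ-≤ (q * n) (+-monoˡ-≤ _ (s≤s k<r)) ⟩
      suc r + (n ∸ (2 + toℕ k)) + q * n         ≡⟨ cong (λ t → suc r + t + q * n) (∸-+-assoc n 2 (toℕ k)) ⟨
      suc r + (n ∸ 2 ∸ toℕ k) + q * n           ≡⟨ rearrange (suc r) _ (q * n) ⟩
      suc (r + q * n) + (n ∸ 2 ∸ toℕ k)         ∎
      where
      2+k≤n : 2 + toℕ k ≤ n
      2+k≤n = ≤-trans (s≤s k<r) r<n
      rearrange : ∀ a b c → a + b + c ≡ a + c + b
      rearrange = solve-∀
    by-cases (no  _)   = begin
      n * (q + 0)                       ≡⟨ trans (n*[q+b]≡ q 0) (cong (_+ q * n) (*-zeroʳ n)) ⟩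
      q * n                             ≤⟨ m≤n+m (q * n) (suc r) ⟩
      suc (r + q * n)                   ≤⟨ m≤m+n _ _ ⟩
      suc (r + q * n) + (n ∸ 2 ∸ toℕ k) ∎

  emitted-elim : ∀ (k : Fin n) (P : ℕ → ℕ → Set) →
                 (∀ q r → r < n → P (r + q * n) (q + 𝟙 (toℕ k <? r))) → ∀ D → P D (emitted D k)
  emitted-elim k P quotRem-case D =
    subst (λ m → P m (emitted m k)) (sym D≡r+q*n)
          (subst (P (r + q * n)) (sym (emitted-quotRem q r k (<⇒≤ r<n))) (quotRem-case q r r<n))
    where
    q = D / n
    r = D % n
    r<n = m%n<n D n
    D≡r+q*n = m≡m%n+[m/n]*n D n

  emitted-lower : ∀ D k → D ≤ n * emitted D k + toℕ k
  emitted-lower D k = emitted-elim k (λ D e → D ≤ n * e + toℕ k) (λ q r → quotRem-lower q r k) D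

  emitted-upper : ∀ D k → n * emitted D k ≤ suc D + (n ∸ 2 ∸ toℕ k)
  emitted-upper D k = emitted-elim k (λ D e → n * e ≤ suc D + (n ∸ 2 ∸ toℕ k)) (λ q r → quotRem-upper q r k) D

module Invariants (d : ℕ) .{{_ : NonZero d}} (ord : Fin (2 * d) → Dir d) where
  open Rotor d ord

  instance
    2d≢0 : NonZero (2 * d)
    2d≢0 = nonZero2d d

  open RotorCount (2 * d)

  received : State d → Site d → ℕ
  received s x = ∑[ k < 2 * d ] emitted (rot s (x ⊕ opposite (ord k))) k

  at : Site d → Site d → ℕ
  at p y = 𝟙 (y ≟ˢ p)

  nobody : Site d → ℕ
  nobody _ = 0

  -- walker y counts a particle standing at y: its visit is recorded, its departure is not yet.
  record Invariant (walker : Site d → ℕ) (s : State d) : Set where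
    field
      vacant⇒rot≡0 : ∀ y → occ s y ≡ false → rot s y ≡ 0
      H≡rot+occ    : ∀ y → H s y ≡ rot s y + bit (occ s y) + walker y
      H≡received   : ∀ x → x ≢ origin d → H s x ≡ received s x
  open Invariant

  advance : State d → Site d → State d
  advance s x = st (occ s) (upd (rot s) x (suc (rot s x))) (H s)

  emitted-advance : ∀ s p y k →
    emitted (rot (advance s p) y) k ≡ emitted (rot s y) k + 𝟙 (y ≟ˢ p) * 𝟙 (slot (rot s p) F.≟ k)
  emitted-advance s p y k with y ≟ˢ p
  ... | yes refl = cong (emitted (rot s y) k +_) (sym (+-identityʳ _))
  ... | no  _    = sym (+-identityʳ _)

  received-advance : ∀ s p x → received (advance s p) x ≡ received s x + 𝟙 (x ≟ˢ p ⊕ rotorDir s p)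
  received-advance s p x = begin
    received (advance s p) x
      ≡⟨ sum-cong-≗ {2 * d} (λ k → emitted-advance s p (y k) k) ⟩
    ∑[ k < 2 * d ] (emitted (rot s (y k)) k + 𝟙 (y k ≟ˢ p) * 𝟙 (r F.≟ k))
      ≡⟨ ∑-distrib-+ (λ k → emitted (rot s (y k)) k) (λ k → 𝟙 (y k ≟ˢ p) * 𝟙 (r F.≟ k)) ⟩
    received s x + ∑[ k < 2 * d ] (𝟙 (y k ≟ˢ p) * 𝟙 (r F.≟ k))
      ≡⟨ cong (received s x +_) (sum-pick (λ k → 𝟙 (y k ≟ˢ p)) r) ⟩
    received s x + 𝟙 (y r ≟ˢ p)
      ≡⟨ cong (received s x +_) (𝟙-cong-⇔ (y r ≟ˢ p) (x ≟ˢ p ⊕ ord r) (⊕-opposite-≡⇔ x p (ord r))) ⟩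
    received s x + 𝟙 (x ≟ˢ p ⊕ ord r) ∎
    where
    open ≡-Reasoning
    y : Fin (2 * d) → Site d
    y k = x ⊕ opposite (ord k)
    r = slot (rot s p)

  received-cong : ∀ {s s'} → (∀ y → rot s y ≡ rot s' y) → ∀ x → received s x ≡ received s' x
  received-cong rot≗ x = sum-cong-≗ {2 * d} (λ k → cong (λ D → emitted D k) (rot≗ (x ⊕ opposite (ord k))))

  initial : Invariant nobody (initState d)
  initial .vacant⇒rot≡0 _ _ = refl
  initial .H≡rot+occ    _   = refl
  initial .H≡received   _ _ = sym (sum-replicate-zero (2 * d))

  deposit : ∀ {s} → Invariant nobody s → Invariant (at (origin d)) (visit s (origin d))
  deposit inv .vacant⇒rot≡0 = inv .vacant⇒rot≡0
  deposit {s} inv .H≡rot+occ y = begin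
    H (visit s (origin d)) y                     ≡⟨ upd-suc (H s) (origin d) y ⟩
    H s y + 𝟙 (y ≟ˢ origin d)                    ≡⟨ cong (_+ 𝟙 (y ≟ˢ origin d)) (inv .H≡rot+occ y) ⟩
    rot s y + bit (occ s y) + 0 + 𝟙 (y ≟ˢ origin d) ≡⟨ cong (_+ 𝟙 (y ≟ˢ origin d)) (+-identityʳ _) ⟩
    rot s y + bit (occ s y) + 𝟙 (y ≟ˢ origin d)  ∎
    where open ≡-Reasoning
  deposit {s} inv .H≡received x x≢o = begin
    H (visit s (origin d)) x  ≡⟨ upd-suc (H s) (origin d) x ⟩
    H s x + 𝟙 (x ≟ˢ origin d) ≡⟨ cong₂ _+_ (inv .H≡received x x≢o) (𝟙-no (x ≟ˢ origin d) x≢o) ⟩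
    received s x + 0          ≡⟨ +-identityʳ _ ⟩
    received s x              ∎
    where open ≡-Reasoning

  occupy : State d → Site d → State d
  occupy s x = st (upd (occ s) x true) (upd (rot s) x 0) (H s)

  settle : ∀ {s p} → occ s p ≡ false → Invariant (at p) s → Invariant nobody (occupy s p)
  settle {s} {p} vacant inv .vacant⇒rot≡0 y with y ≟ˢ p
  ... | yes refl = λ ()
  ... | no  _    = inv .vacant⇒rot≡0 y
  settle {s} {p} vacant inv .H≡rot+occ y with y ≟ˢ p | inv .H≡rot+occ y
  ... | yes refl | H≡ = trans H≡ (cong₂ (λ r o → r + bit o + 1) (inv .vacant⇒rot≡0 p vacant) vacant)
  ... | no  _    | H≡ = H≡
  settle {s} {p} vacant inv .H≡received x x≢o =
    trans (inv .H≡received x x≢o) (received-cong {s} {occupy s p} (λ y → sym (upd-self (rot s) p (inv .vacant⇒rot≡0 p vacant) y)) x)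

  move : ∀ {s p} → occ s p ≡ true → Invariant (at p) s →
         Invariant (at (p ⊕ rotorDir s p)) (visit (advance s p) (p ⊕ rotorDir s p))
  move {s} {p} occupied inv .vacant⇒rot≡0 y vacant = trans (upd-≢ (rot s) p _ y≢p) (inv .vacant⇒rot≡0 y vacant)
    where
    y≢p : y ≢ p
    y≢p refl with () ← trans (sym occupied) vacant
  move {s} {p} occupied inv .H≡rot+occ y = begin
    H (visit (advance s p) q) y                        ≡⟨ upd-suc (H s) q y ⟩
    H s y + 𝟙 (y ≟ˢ q)                                 ≡⟨ cong (_+ 𝟙 (y ≟ˢ q)) (inv .H≡rot+occ y) ⟩
    rot s y + bit (occ s y) + 𝟙 (y ≟ˢ p) + 𝟙 (y ≟ˢ q)  ≡⟨ cong (_+ 𝟙 (y ≟ˢ q)) (+-comm-middle (rot s y) _ _) ⟩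
    rot s y + 𝟙 (y ≟ˢ p) + bit (occ s y) + 𝟙 (y ≟ˢ q)  ≡⟨ cong (λ r → r + bit (occ s y) + 𝟙 (y ≟ˢ q)) (upd-suc (rot s) p y) ⟨
    rot (advance s p) y + bit (occ s y) + 𝟙 (y ≟ˢ q)   ∎
    where
    open ≡-Reasoning
    q = p ⊕ rotorDir s p
    +-comm-middle : ∀ a b c → a + b + c ≡ a + c + b
    +-comm-middle = solve-∀
  move {s} {p} occupied inv .H≡received x x≢o = begin
    H (visit (advance s p) q) x ≡⟨ upd-suc (H s) q x ⟩
    H s x + 𝟙 (x ≟ˢ q)        ≡⟨ cong (_+ 𝟙 (x ≟ˢ q)) (inv .H≡received x x≢o) ⟩
    received s x + 𝟙 (x ≟ˢ q) ≡⟨ received-advance s p x ⟨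
    received (advance s p) x  ∎
    where
    open ≡-Reasoning
    q = p ⊕ rotorDir s p

  walk-invariant : ∀ {s p s'} → Walk s p s' → Invariant (at p) s → Invariant nobody s'
  walk-invariant (stop vacant)     inv = settle vacant inv
  walk-invariant (step occupied w) inv = walk-invariant w (move occupied inv)

  run-invariant : ∀ {m s} → Run m s → Invariant nobody s
  run-invariant run0       = initial
  run-invariant (runS r w) = walk-invariant w (deposit (run-invariant r))

  neighbourVisits : State d → Site d → ℕ
  neighbourVisits s x = ∑[ k < 2 * d ] H s (x ⊕ opposite (ord k))

  module _ {s : State d} (inv : Invariant nobody s) where

    occupied-H : ∀ {y} → occ s y ≡ true → H s y ≡ suc (rot s y)
    occupied-H {y} occupied = begin
      H s y                    ≡⟨ inv .H≡rot+occ y ⟩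
      rot s y + bit (occ s y) + 0 ≡⟨ +-identityʳ _ ⟩
      rot s y + bit (occ s y)  ≡⟨ cong (λ o → rot s y + bit o) occupied ⟩
      rot s y + 1              ≡⟨ +-comm (rot s y) 1 ⟩
      suc (rot s y)            ∎
      where open ≡-Reasoning

    vacant-H : ∀ {y} → occ s y ≡ false → H s y ≡ 0
    vacant-H {y} vacant = begin
      H s y                    ≡⟨ inv .H≡rot+occ y ⟩
      rot s y + bit (occ s y) + 0 ≡⟨ cong₂ (λ r o → r + bit o + 0) (inv .vacant⇒rot≡0 y vacant) vacant ⟩
      0                        ∎
      where open ≡-Reasoning

    visits-≤ : ∀ y k → H s y ≤ 2 * d * emitted (rot s y) k + suc (toℕ k)
    visits-≤ y k with occ s y in eq
    ... | true  = begin
      H s y                                       ≡⟨ occupied-H eq ⟩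
      suc (rot s y)                               ≤⟨ s≤s (emitted-lower (rot s y) k) ⟩
      suc (2 * d * emitted (rot s y) k + toℕ k)   ≡⟨ +-suc _ (toℕ k) ⟨
      2 * d * emitted (rot s y) k + suc (toℕ k)   ∎
      where open ≤-Reasoning
    ... | false = ≤-trans (≤-reflexive (vacant-H eq)) z≤n

    -- The truncated slack also covers vacant sites, where both H and the emissions vanish.
    visits-≥ : ∀ y k → 2 * d * emitted (rot s y) k ≤ H s y + (2 * d ∸ 2 ∸ toℕ k)
    visits-≥ y k with occ s y in eq
    ... | true  = begin
      2 * d * emitted (rot s y) k              ≤⟨ emitted-upper (rot s y) k ⟩
      suc (rot s y) + (2 * d ∸ 2 ∸ toℕ k)      ≡⟨ cong (_+ (2 * d ∸ 2 ∸ toℕ k)) (occupied-H eq) ⟨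
      H s y + (2 * d ∸ 2 ∸ toℕ k)              ∎
      where open ≤-Reasoning
    ... | false = begin
      2 * d * emitted (rot s y) k              ≡⟨ cong (λ D → 2 * d * emitted D k) (inv .vacant⇒rot≡0 y eq) ⟩
      2 * d * 0                                ≡⟨ *-zeroʳ (2 * d) ⟩
      0                                        ≤⟨ z≤n ⟩
      H s y + (2 * d ∸ 2 ∸ toℕ k)              ∎
      where open ≤-Reasoning

    module _ {x : Site d} (x≢o : x ≢ origin d) where
      private
        y : Fin (2 * d) → Site d
        y k = x ⊕ opposite (ord k)

        n*H≡∑ : 2 * d * H s x ≡ ∑[ k < 2 * d ] (2 * d * emitted (rot s (y k)) k)
        n*H≡∑ = trans (cong (2 * d *_) (inv .H≡received x x≢o)) (*-distribˡ-sum {2 * d} (2 * d) (λ k → emitted (rot s (y k)) k))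

      neighbourVisits-≤ : neighbourVisits s x ≤ 2 * d * H s x + ∑[ k < 2 * d ] suc (toℕ k)
      neighbourVisits-≤ = begin
        ∑[ k < 2 * d ] H s (y k)
          ≤⟨ sum-mono-≤ (λ k → visits-≤ (y k) k) ⟩
        ∑[ k < 2 * d ] (2 * d * emitted (rot s (y k)) k + suc (toℕ k))
          ≡⟨ ∑-distrib-+ (λ k → 2 * d * emitted (rot s (y k)) k) (λ k → suc (toℕ k)) ⟩
        ∑[ k < 2 * d ] (2 * d * emitted (rot s (y k)) k) + ∑[ k < 2 * d ] suc (toℕ k)
          ≡⟨ cong (_+ ∑[ k < 2 * d ] suc (toℕ k)) n*H≡∑ ⟨
        2 * d * H s x + ∑[ k < 2 * d ] suc (toℕ k) ∎
        where open ≤-Reasoning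

      neighbourVisits-≥ : 2 * d * H s x ≤ neighbourVisits s x + ∑[ k < 2 * d ] (2 * d ∸ 2 ∸ toℕ k)
      neighbourVisits-≥ = begin
        2 * d * H s x
          ≡⟨ n*H≡∑ ⟩
        ∑[ k < 2 * d ] (2 * d * emitted (rot s (y k)) k)
          ≤⟨ sum-mono-≤ (λ k → visits-≥ (y k) k) ⟩
        ∑[ k < 2 * d ] (H s (y k) + (2 * d ∸ 2 ∸ toℕ k))
          ≡⟨ ∑-distrib-+ (λ k → H s (y k)) (λ k → 2 * d ∸ 2 ∸ toℕ k) ⟩
        ∑[ k < 2 * d ] H s (y k) + ∑[ k < 2 * d ] (2 * d ∸ 2 ∸ toℕ k) ∎
        where open ≤-Reasoning

      2*neighbourVisits-≤ : 2 * neighbourVisits s x ≤ 2 * (2 * d * H s x) + 2 * d * suc (2 * d)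
      2*neighbourVisits-≤ = begin
        2 * neighbourVisits s x
          ≤⟨ *-monoʳ-≤ 2 neighbourVisits-≤ ⟩
        2 * (2 * d * H s x + ∑[ k < 2 * d ] suc (toℕ k))
          ≡⟨ *-distribˡ-+ 2 (2 * d * H s x) _ ⟩
        2 * (2 * d * H s x) + 2 * ∑[ k < 2 * d ] suc (toℕ k)
          ≡⟨ cong (2 * (2 * d * H s x) +_) (2*∑suc≡ (2 * d)) ⟩
        2 * (2 * d * H s x) + 2 * d * suc (2 * d) ∎
        where open ≤-Reasoning

      2*neighbourVisits-≥ : 2 * (2 * d * H s x) ≤ 2 * neighbourVisits s x + (2 * d ∸ 2) * suc (2 * d ∸ 2)
      2*neighbourVisits-≥ = begin
        2 * (2 * d * H s x)
          ≤⟨ *-monoʳ-≤ 2 neighbourVisits-≥ ⟩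
        2 * (neighbourVisits s x + ∑[ k < 2 * d ] (2 * d ∸ 2 ∸ toℕ k))
          ≡⟨ *-distribˡ-+ 2 (neighbourVisits s x) _ ⟩
        2 * neighbourVisits s x + 2 * ∑[ k < 2 * d ] (2 * d ∸ 2 ∸ toℕ k)
          ≤⟨ +-monoʳ-≤ (2 * neighbourVisits s x) (2*∑∸≤ (2 * d) (2 * d ∸ 2)) ⟩
        2 * neighbourVisits s x + (2 * d ∸ 2) * suc (2 * d ∸ 2) ∎
        where open ≤-Reasoning

  Δ-Hℤ : Bijective _≡_ _≡_ ord → ∀ s x →
         Δ (Hℤ s) x ≡ ℤ.+ neighbourVisits s x ℚ./ (2 * d) ℚ.- ℤ.+ H s x ℚ./ 1
  Δ-Hℤ ord-bij s x = cong (λ i → i ℚ./ (2 * d) ℚ.- ℤ.+ H s x ℚ./ 1)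
    (trans (sumE-+ (H s) x) (cong ℤ.+_ (sym (sum-∘-bijection ord ord-bij (λ ε → H s (x ⊕ opposite ε))))))

-- ℚ normalises by gcd, so inequalities are cross-multiplied in ℚᵘ, whose numerators and
-- denominators are literally the products appearing in the definitions.
module Rational where
  open import Data.Integer using (+_)
  open import Data.Integer.Tactic.RingSolver using () renaming (solve-∀ to ring-solve-∀)
  import Data.Rational.Properties as ℚP
  open import Data.Rational.Unnormalised as ℚᵘ using (ℚᵘ; mkℚᵘ; *≤*; ↥_; ↧_)
  import Data.Rational.Unnormalised.Properties as ℚᵘP

  toℚᵘ-/ : ∀ i n .{{_ : NonZero n}} → toℚᵘ (i ℚ./ n) ℚᵘ.≃ i ℚᵘ./ n
  toℚᵘ-/ i (suc m) = ℚP.toℚᵘ-fromℚᵘ (mkℚᵘ i m)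

  toℚᵘ-- : ∀ p q → toℚᵘ (p ℚ.- q) ℚᵘ.≃ toℚᵘ p ℚᵘ.- toℚᵘ q
  toℚᵘ-- p q = ℚᵘP.≃-trans (ℚP.toℚᵘ-homo-+ p (ℚ.- q)) (ℚᵘP.+-congʳ (toℚᵘ p) (ℚP.toℚᵘ-homo‿- q))

  toℚᵘ-/-/ : ∀ a m b k .{{_ : NonZero m}} .{{_ : NonZero k}} →
             toℚᵘ (a ℚ./ m ℚ.- b ℚ./ k) ℚᵘ.≃ a ℚᵘ./ m ℚᵘ.- b ℚᵘ./ k
  toℚᵘ-/-/ a m b k = ℚᵘP.≃-trans (toℚᵘ-- (a ℚ./ m) (b ℚ./ k)) (ℚᵘP.+-cong (toℚᵘ-/ a m) (ℚᵘP.-‿cong (toℚᵘ-/ b k)))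

  toℚᵘ-/+/ : ∀ a m b k .{{_ : NonZero m}} .{{_ : NonZero k}} →
             toℚᵘ (a ℚ./ m ℚ.+ b ℚ./ k) ℚᵘ.≃ a ℚᵘ./ m ℚᵘ.+ b ℚᵘ./ k
  toℚᵘ-/+/ a m b k = ℚᵘP.≃-trans (ℚP.toℚᵘ-homo-+ (a ℚ./ m) (b ℚ./ k)) (ℚᵘP.+-cong (toℚᵘ-/ a m) (toℚᵘ-/ b k))

  ≤+⇒-≤ : ∀ {a} b {c} → a ℤ.≤ b ℤ.+ c → a ℤ.- b ℤ.≤ c
  ≤+⇒-≤ {a} b {c} a≤b+c = ℤP.≤-trans (ℤP.+-monoˡ-≤ (ℤ.- b) a≤b+c) (ℤP.≤-reflexive (cancel b c))
    where
    cancel : ∀ b c → b ℤ.+ c ℤ.- b ≡ c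
    cancel = ring-solve-∀

  ≤+⇒-‿≤- : ∀ a {b c} → b ℤ.≤ a ℤ.+ c → ℤ.- c ℤ.≤ a ℤ.- b
  ≤+⇒-‿≤- a {b} {c} b≤a+c = begin
    ℤ.- c                            ≡⟨ cancelˡ b c ⟨
    b ℤ.+ (ℤ.- c ℤ.- b)              ≤⟨ ℤP.+-monoˡ-≤ (ℤ.- c ℤ.- b) b≤a+c ⟩
    a ℤ.+ c ℤ.+ (ℤ.- c ℤ.- b)        ≡⟨ cancelʳ a b c ⟩
    a ℤ.- b                          ∎
    where
    open ℤP.≤-Reasoning
    cancelˡ : ∀ b c → b ℤ.+ (ℤ.- c ℤ.- b) ≡ ℤ.- c
    cancelˡ = ring-solve-∀
    cancelʳ : ∀ a b c → a ℤ.+ c ℤ.+ (ℤ.- c ℤ.- b) ≡ a ℤ.- b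
    cancelʳ = ring-solve-∀

  ≤-via-ℚᵘ : ∀ {p q p′ q′} → toℚᵘ p ℚᵘ.≃ p′ → toℚᵘ q ℚᵘ.≃ q′ → p′ ℚᵘ.≤ q′ → p ℚ.≤ q
  ≤-via-ℚᵘ p≃ q≃ p′≤q′ = ℚP.toℚᵘ-cancel-≤ (ℚᵘP.≤-respˡ-≃ (ℚᵘP.≃-sym p≃) (ℚᵘP.≤-respʳ-≃ (ℚᵘP.≃-sym q≃) p′≤q′))

  module _ (e : ℕ) where
    private
      d = suc e
      n = 2 * d

      E N : ℤ
      E = + e
      N = + 2 ℤ.* (+ 1 ℤ.+ E)

      Δᵘ : ℕ → ℕ → ℚᵘ
      Δᵘ S H = + S ℚᵘ./ n ℚᵘ.- + H ℚᵘ./ 1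

      upperᵘ lowerᵘ : ℚᵘ
      upperᵘ = + d ℚᵘ./ 1 ℚᵘ.+ + 1 ℚᵘ./ 2
      lowerᵘ = ℤ.- + d ℚᵘ./ 1 ℚᵘ.+ + 3 ℚᵘ./ 2 ℚᵘ.- + 1 ℚᵘ./ n

      toℚᵘ-Δ : ∀ S H → toℚᵘ (+ S ℚ./ n ℚ.- + H ℚ./ 1) ℚᵘ.≃ Δᵘ S H
      toℚᵘ-Δ S H = toℚᵘ-/-/ (+ S) n (+ H) 1

      toℚᵘ-upperBound : toℚᵘ (upperBound d) ℚᵘ.≃ upperᵘ
      toℚᵘ-upperBound = toℚᵘ-/+/ (+ d) 1 (+ 1) 2

      toℚᵘ-lowerBound : toℚᵘ (lowerBound d) ℚᵘ.≃ lowerᵘ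
      toℚᵘ-lowerBound = ℚᵘP.≃-trans (toℚᵘ-- (ℤ.- + d ℚ./ 1 ℚ.+ + 3 ℚ./ 2) (+ 1 ℚ./ n))
                          (ℚᵘP.+-cong (toℚᵘ-/+/ (ℤ.- + d) 1 (+ 3) 2) (ℚᵘP.-‿cong (toℚᵘ-/ (+ 1) n)))

      +2*n*H≡ : ∀ H → + (2 * (n * H)) ≡ + 2 ℤ.* (N ℤ.* + H)
      +2*n*H≡ H = trans (ℤP.pos-* 2 (n * H)) (cong (+ 2 ℤ.*_) (ℤP.pos-* n H))

    Δ≤upperBound : ∀ S H → 2 * S ≤ 2 * (n * H) + n * suc n → + S ℚ./ n ℚ.- + H ℚ./ 1 ℚ.≤ upperBound d
    Δ≤upperBound S H hyp = ≤-via-ℚᵘ (toℚᵘ-Δ S H) toℚᵘ-upperBound (*≤* (begin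
      ↥ Δᵘ S H ℤ.* ↧ upperᵘ                       ≡⟨ lhs (+ S) (+ H) E ⟩
      + 2 ℤ.* + S ℤ.- + 2 ℤ.* (N ℤ.* + H)         ≤⟨ ≤+⇒-≤ (+ 2 ℤ.* (N ℤ.* + H)) hypℤ ⟩
      N ℤ.* (+ 1 ℤ.+ N)                           ≡⟨ rhs E ⟨
      ↥ upperᵘ ℤ.* ↧ Δᵘ S H                       ∎))
      where
      open ℤP.≤-Reasoning
      hypℤ : + 2 ℤ.* + S ℤ.≤ + 2 ℤ.* (N ℤ.* + H) ℤ.+ N ℤ.* (+ 1 ℤ.+ N)
      hypℤ = subst₂ ℤ._≤_ (ℤP.pos-* 2 S)
               (trans (ℤP.pos-+ (2 * (n * H)) (n * suc n)) (cong₂ ℤ._+_ (+2*n*H≡ H) (ℤP.pos-* n (suc n))))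
               (ℤ.+≤+ hyp)
      lhs : ∀ S H E → let N = + 2 ℤ.* (+ 1 ℤ.+ E) in
            (S ℤ.* + 1 ℤ.+ ℤ.- H ℤ.* N) ℤ.* (+ 1 ℤ.* + 2) ≡ + 2 ℤ.* S ℤ.- + 2 ℤ.* (N ℤ.* H)
      lhs = ring-solve-∀
      rhs : ∀ E → let N = + 2 ℤ.* (+ 1 ℤ.+ E) in
            ((+ 1 ℤ.+ E) ℤ.* + 2 ℤ.+ + 1 ℤ.* + 1) ℤ.* (N ℤ.* + 1) ≡ N ℤ.* (+ 1 ℤ.+ N)
      rhs = ring-solve-∀

    lowerBound≤Δ : ∀ S H → 2 * (n * H) ≤ 2 * S + (n ∸ 2) * suc (n ∸ 2) →
                   lowerBound d ℚ.≤ + S ℚ./ n ℚ.- + H ℚ./ 1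
    lowerBound≤Δ S H hyp = ≤-via-ℚᵘ toℚᵘ-lowerBound (toℚᵘ-Δ S H) (*≤* (begin
      ↥ lowerᵘ ℤ.* ↧ Δᵘ S H                        ≡⟨ lhs E ⟩
      ℤ.- C ℤ.* N                                  ≤⟨ ℤP.*-monoʳ-≤-nonNeg N (≤+⇒-‿≤- (+ 2 ℤ.* + S) hypℤ) ⟩
      (+ 2 ℤ.* + S ℤ.- + 2 ℤ.* (N ℤ.* + H)) ℤ.* N  ≡⟨ rhs (+ S) (+ H) E ⟨
      ↥ Δᵘ S H ℤ.* ↧ lowerᵘ                        ∎))
      where
      open ℤP.≤-Reasoning
      C : ℤ
      C = (+ 2 ℤ.* E) ℤ.* (+ 1 ℤ.+ + 2 ℤ.* E)
      +[n∸2]*[1+n∸2]≡C : + ((n ∸ 2) * suc (n ∸ 2)) ≡ C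
      +[n∸2]*[1+n∸2]≡C = begin-equality
        + ((n ∸ 2) * suc (n ∸ 2))        ≡⟨ cong (λ m → + (m * suc m)) (cong (_∸ 1) (+-suc e (e + 0))) ⟩
        + (2 * e * suc (2 * e))          ≡⟨ ℤP.pos-* (2 * e) (suc (2 * e)) ⟩
        + (2 * e) ℤ.* (+ 1 ℤ.+ + (2 * e)) ≡⟨ cong (λ a → a ℤ.* (+ 1 ℤ.+ a)) (ℤP.pos-* 2 e) ⟩
        C                                ∎
      hypℤ : + 2 ℤ.* (N ℤ.* + H) ℤ.≤ + 2 ℤ.* + S ℤ.+ C
      hypℤ = subst₂ ℤ._≤_ (+2*n*H≡ H)
               (trans (ℤP.pos-+ (2 * S) _) (cong₂ ℤ._+_ (ℤP.pos-* 2 S) +[n∸2]*[1+n∸2]≡C))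
               (ℤ.+≤+ hyp)
      lhs : ∀ E → let N = + 2 ℤ.* (+ 1 ℤ.+ E) in
            ((ℤ.- (+ 1 ℤ.+ E) ℤ.* + 2 ℤ.+ + 3 ℤ.* + 1) ℤ.* N ℤ.+ ℤ.- + 1 ℤ.* (+ 1 ℤ.* + 2)) ℤ.* (N ℤ.* + 1)
              ≡ ℤ.- ((+ 2 ℤ.* E) ℤ.* (+ 1 ℤ.+ + 2 ℤ.* E)) ℤ.* N
      lhs = ring-solve-∀
      rhs : ∀ S H E → let N = + 2 ℤ.* (+ 1 ℤ.+ E) in
            (S ℤ.* + 1 ℤ.+ ℤ.- H ℤ.* N) ℤ.* ((+ 1 ℤ.* + 2) ℤ.* N) ≡ (+ 2 ℤ.* S ℤ.- + 2 ℤ.* (N ℤ.* H)) ℤ.* N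
      rhs = ring-solve-∀

open Rational using (Δ≤upperBound; lowerBound≤Δ)

lemma4p2 : (d : ℕ) → .{{_ : NonZero d}} →
           (ord : Fin (2 ℕ.* d) → Dir d) → Bijective _≡_ _≡_ ord →
           (m : ℕ) → m ≥ 1 → (s : State d) → Rotor.Run d ord m s →
           (x : Site d) → x ≢ origin d →
           (lowerBound d ℚ.≤ Δ (Rotor.Hℤ d ord s) x)
           × (Δ (Rotor.Hℤ d ord s) x ℚ.≤ upperBound d)
lemma4p2 d@(suc e) ord ord-bij _ _ s run x x≢o =
  subst (lowerBound d ℚ.≤_) (sym Δ≡) (lowerBound≤Δ e N (H s x) (2*neighbourVisits-≥ inv x≢o)) ,
  subst (ℚ._≤ upperBound d) (sym Δ≡) (Δ≤upperBound e N (H s x) (2*neighbourVisits-≤ inv x≢o))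
  where
  open Invariants d ord
  inv = run-invariant run
  N = neighbourVisits s x
  Δ≡ : Δ (Rotor.Hℤ d ord s) x ≡ ℤ.+ N ℚ./ (2 * d) ℚ.- ℤ.+ H s x ℚ./ 1
  Δ≡ = Δ-Hℤ ord-bij s x
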